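{- Let $D=(\Sigma,A)$ be a decoder with $|\Sigma|=k$. A graph $G=(V,E)$ is a letter graph over $D$ if and only if there exists a letter assignment $\ell:V\to\Sigma$ such that (C1) for every $a\in\Sigma$ with $|\ell^{ -1}(a)|\ge 2$, the set $\ell^{ -1}(a)$ is a clique if and only if $(a,a)\in A$; (C2) for every $a\in\Sigma$ with $|\ell^{ -1}(a)|\ge 2$, the set $\ell^{ -1}(a)$ is an independent set if and only if $(a,a)\notin A$; (C3) for any two distinct $a,b\in\Sigma$: if $(a,b),(b,a)\in A$ then the bipartite graph $G[\ell^{ -1}(a),\ell^{ -1}(b)]$ is complete bipartite, and if $(a,b),(b,a)\notin A$ then it is edgeless; (C4) the compatibility graph $\mathsf{CG}(G,D,\ell)$ is acyclic. Moreover, if $\ell$ satisfies (C1)–(C4), then for any topological ordering $\pi$ of $\mathsf{CG}(G,D,\ell)$, the pair $(\ell,\pi)$ is a letter realisation of $G$ over $D$.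
   Context: A decoder is a directed graph $D=(\Sigma,A)$ (loops allowed) on a finite alphabet $\Sigma$. An $n$-vertex graph $G=(V,E)$ is a letter graph over $D$ if there exist a map $\ell:V\to\Sigma$ and a bijection $c:V\to[n]$ such that two distinct vertices $x,y$ are adjacent iff either $(\ell(x),\ell(y))\in A$ and $c(x)<c(y)$, or $(\ell(y),\ell(x))\in A$ and $c(y)<c(x)$; $(\ell,c)$ is then called a letter realisation of $G$ over $D$. For disjoint $X,Y\subseteq V$, $G[X,Y]$ is the bipartite graph on $X\cup Y$ with the edges of $G$ between $X$ and $Y$. The compatibility graph $\mathsf{CG}(G,D,\ell)$ is the directed graph with vertex set $V$ and arc set $\bigcup_{(a,b)\in A,\,(b,a)\notin A}\big(\{(x,y): \ell(x)=a,\ell(y)=b,xy\in E\}\cup\{(y,x):\ell(x)=a,\ell(y)=b,xy\notin E\}\big)$. A topological ordering of a directed graph on $n$ vertices is a bijection $\pi$ from its vertex set to $[n]$ with $\pi(x)<\pi(y)$ for every arc $(x,y)$. -}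

module Defs where

open import Data.Nat using (ℕ)
open import Data.Fin using (Fin; _<_)
open import Data.Product using (Σ; ∃; ∃-syntax; _×_; _,_)
open import Data.Sum using (_⊎_)
open import Relation.Nullary using (¬_)
open import Relation.Binary using (Decidable)
open import Relation.Binary.PropositionalEquality using (_≡_; _≢_)
open import Relation.Binary.Construct.Closure.Transitive using (TransClosure)
open import Function.Bundles using (_⤖_; Bijection)

record Decoder (k : ℕ) : Set₁ where
  field
    Arc  : Fin k → Fin k → Set
    arc? : Decidable Arc
open Decoder public

record Graph (n : ℕ) : Set₁ where
  field
    Adj     : Fin n → Fin n → Set
    adj?    : Decidable Adj
    sym     : ∀ {x y} → Adj x y → Adj y x
    irrefl  : ∀ {x} → ¬ Adj x x
open Graph public

module _ {k n : ℕ} (D : Decoder k) (G : Graph n) where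

  IsLetterRealisation : (Fin n → Fin k) → (Fin n ⤖ Fin n) → Set
  IsLetterRealisation ℓ c =
    ∀ x y → x ≢ y →
      (Adj G x y → (Arc D (ℓ x) (ℓ y) × c' x < c' y) ⊎ (Arc D (ℓ y) (ℓ x) × c' y < c' x))
    × ((Arc D (ℓ x) (ℓ y) × c' x < c' y) ⊎ (Arc D (ℓ y) (ℓ x) × c' y < c' x) → Adj G x y)
    where c' = Bijection.to c

  IsLetterGraph : Set
  IsLetterGraph = Σ (Fin n → Fin k) λ ℓ → Σ (Fin n ⤖ Fin n) λ c → IsLetterRealisation ℓ c

  module _ (ℓ : Fin n → Fin k) where

    AtLeastTwo : Fin k → Set
    AtLeastTwo a = ∃[ x ] ∃[ y ] (x ≢ y × ℓ x ≡ a × ℓ y ≡ a)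

    IsClique : Fin k → Set
    IsClique a = ∀ x y → ℓ x ≡ a → ℓ y ≡ a → x ≢ y → Adj G x y

    IsIndependent : Fin k → Set
    IsIndependent a = ∀ x y → ℓ x ≡ a → ℓ y ≡ a → ¬ Adj G x y

    C1 : Set
    C1 = ∀ a → AtLeastTwo a → (IsClique a → Arc D a a) × (Arc D a a → IsClique a)

    C2 : Set
    C2 = ∀ a → AtLeastTwo a → (IsIndependent a → ¬ Arc D a a) × (¬ Arc D a a → IsIndependent a)

    C3 : Set
    C3 = ∀ a b → a ≢ b →
           (Arc D a b → Arc D b a → ∀ x y → ℓ x ≡ a → ℓ y ≡ b → Adj G x y)
         × (¬ Arc D a b → ¬ Arc D b a → ∀ x y → ℓ x ≡ a → ℓ y ≡ b → ¬ Adj G x y)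

    data CGArc : Fin n → Fin n → Set where
      fwd : ∀ {x y} → Arc D (ℓ x) (ℓ y) → ¬ Arc D (ℓ y) (ℓ x) → Adj G x y → CGArc x y
      bwd : ∀ {x y} → Arc D (ℓ y) (ℓ x) → ¬ Arc D (ℓ x) (ℓ y) → ¬ Adj G x y → CGArc x y

    Acyclic : Set
    Acyclic = ∀ x → ¬ TransClosure CGArc x x

    C4 : Set
    C4 = Acyclic

    IsTopologicalOrdering : (Fin n ⤖ Fin n) → Set
    IsTopologicalOrdering π = ∀ x y → CGArc x y → Bijection.to π x < Bijection.to π y

{-# OPTIONS --safe #-}
-- Between two vertices whose letters are joined by both arcs or by no arc of D (in particular
-- inside a letter class), adjacency in a realisation does not depend on the order; C1–C3 say
-- exactly that it has the forced value. Between letters joined by exactly one arc (a , b), a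
-- vertex x of letter a and y of letter b are adjacent iff x comes before y, which is precisely
-- an arc of CG between them. Hence the realisations with letters ℓ are the topological
-- orderings of CG, and these exist iff CG is acyclic (place a source first and recurse).
module Submission where

open import Defs
open import Data.Nat using (ℕ; zero; suc; _+_; z<s; s<s)
import Data.Nat as ℕ
open import Data.Nat.Properties using (n<1+n; +-comm; m≤n⇒∃[o]m+o≡n)
open import Data.Fin using (Fin; zero; suc; toℕ; punchIn; _<_; _≟_)
open import Data.Fin.Properties using (<-cmp; <-asym; <-irrefl; <-trans; pigeonhole; any?; all?; ¬∀⟶∃¬; punchIn-punchOut)
open import Data.Fin.Permutation using (Permutation′; _⟨$⟩ʳ_; insert; insert-punchIn; inverseʳ)
import Data.Fin.Permutation as Permutation
open import Data.Product using (Σ; ∃; _×_; _,_; proj₁; proj₂; map₂)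
open import Data.Sum using (_⊎_; inj₁; inj₂; reduce)
import Data.Sum as Sum
open import Data.Empty using (⊥-elim)
open import Function.Base using (_∘_; id; const)
open import Function.Bundles using (_⤖_; Bijection)
open import Function.Properties.Inverse using (↔⇒⤖)
import Function.Endo.Propositional as Endo
open import Level using (0ℓ)
open import Relation.Nullary using (¬_; yes; no; contradiction)
open import Relation.Nullary.Decidable using (¬?; _×-dec_; _⊎-dec_; map′; decidable-stable)
open import Relation.Binary using (Rel; Decidable; tri<; tri≈; tri>)
open import Relation.Binary.PropositionalEquality using (_≡_; _≢_; refl; trans; cong; cong-app; subst; module ≡-Reasoning)
import Relation.Binary.PropositionalEquality as ≡
open import Relation.Binary.Construct.Closure.Transitive using (TransClosure; [_]; _∷_; transitive⁻)

IsAcyclic : {A : Set} → Rel A 0ℓ → Set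
IsAcyclic R = ∀ x → ¬ TransClosure R x x

<-acyclic : ∀ {n} → IsAcyclic (_<_ {n})
<-acyclic x cycle = <-irrefl refl (transitive⁻ _<_ <-trans cycle)

acyclic-pullback : {A B : Set} {R : Rel A 0ℓ} {S : Rel B 0ℓ} (f : A → B) →
                   (∀ {x y} → R x y → S (f x) (f y)) → IsAcyclic S → IsAcyclic R
acyclic-pullback {R = R} {S} f R⇒S acyclic x = acyclic (f x) ∘ walk
  where
  walk : ∀ {x y} → TransClosure R x y → TransClosure S (f x) (f y)
  walk [ r ]    = [ R⇒S r ]
  walk (r ∷ rs) = R⇒S r ∷ walk rs

module _ {A : Set} {R : Rel A 0ℓ} (pred : A → A) (pred-R : ∀ x → R (pred x) x) where

  open Endo A using (_^_; ^-homo)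

  predecessor-walk : ∀ d x → TransClosure R ((pred ^ suc d) x) x
  predecessor-walk zero    x = [ pred-R x ]
  predecessor-walk (suc d) x = pred-R _ ∷ predecessor-walk d x

  repeated-predecessor⇒cycle : ∀ x₀ {i j} → i ℕ.< j → (pred ^ i) x₀ ≡ (pred ^ j) x₀ →
                               TransClosure R ((pred ^ i) x₀) ((pred ^ i) x₀)
  repeated-predecessor⇒cycle x₀ {i} {j} i<j repeated =
    let d , 1+i+d≡j = m≤n⇒∃[o]m+o≡n i<j
        returns : (pred ^ suc d) ((pred ^ i) x₀) ≡ (pred ^ i) x₀
        returns = begin
          (pred ^ suc d) ((pred ^ i) x₀) ≡⟨ cong-app (^-homo pred (suc d) i) x₀ ⟨
          (pred ^ (suc d + i)) x₀        ≡⟨ cong (λ m → (pred ^ m) x₀) (trans (cong suc (+-comm d i)) 1+i+d≡j) ⟩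
          (pred ^ j) x₀                  ≡⟨ repeated ⟨
          (pred ^ i) x₀                  ∎
    in subst (λ z → TransClosure R z ((pred ^ i) x₀)) returns (predecessor-walk d ((pred ^ i) x₀))
    where open ≡-Reasoning

-- If every vertex had a predecessor, the first n + 1 iterated predecessors of x₀ would
-- repeat by pigeonhole, closing a cycle.
acyclic⇒source : ∀ {n} {R : Rel (Fin n) 0ℓ} → Decidable R → IsAcyclic R → Fin n → ∃ λ s → ∀ x → ¬ R x s
acyclic⇒source {n} {R} R? acyclic x₀ with any? (λ s → all? (λ x → ¬? (R? x s)))
... | yes source = source
... | no ¬source =
  let i , j , i<j , repeated = pigeonhole (n<1+n n) (λ i → (pred ^ toℕ i) x₀)
  in  ⊥-elim (acyclic _ (repeated-predecessor⇒cycle pred (proj₂ ∘ has-predecessor) x₀ i<j repeated))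
  where
  open Endo (Fin n) using (_^_)

  has-predecessor : ∀ s → ∃ λ x → R x s
  has-predecessor s = map₂ (λ {x} → decidable-stable (R? x s))
                           (¬∀⟶∃¬ n _ (λ x → ¬? (R? x s)) (¬source ∘ (s ,_)))

  pred : Fin n → Fin n
  pred = proj₁ ∘ has-predecessor

≡⊎punchIn : ∀ {n} (s x : Fin (suc n)) → x ≡ s ⊎ ∃ λ x′ → punchIn s x′ ≡ x
≡⊎punchIn s x with x ≟ s
... | yes x≡s = inj₁ x≡s
... | no  x≢s = inj₂ (_ , punchIn-punchOut (x≢s ∘ ≡.sym))

TopologicalOrdering : ∀ {n} → Rel (Fin n) 0ℓ → Permutation′ n → Set
TopologicalOrdering R π = ∀ x y → R x y → π ⟨$⟩ʳ x < π ⟨$⟩ʳ y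

topologicalOrdering : ∀ {n} {R : Rel (Fin n) 0ℓ} → Decidable R → IsAcyclic R →
                      Σ (Permutation′ n) (TopologicalOrdering R)
topologicalOrdering {zero}      R? acyclic = Permutation.id , λ ()
topologicalOrdering {suc n} {R} R? acyclic with acyclic⇒source R? acyclic zero
... | s , s-source
    with topologicalOrdering {R = λ x y → R (punchIn s x) (punchIn s y)}
           (λ x y → R? (punchIn s x) (punchIn s y)) (acyclic-pullback (punchIn s) id acyclic)
... | π′ , π′-ordering = π , π-ordering
  where
  π : Permutation′ (suc n)
  π = insert s zero π′

  π-source : π ⟨$⟩ʳ s ≡ zero
  π-source = inverseʳ π

  π-punchIn : ∀ x → π ⟨$⟩ʳ punchIn s x ≡ suc (π′ ⟨$⟩ʳ x)
  π-punchIn = insert-punchIn s zero π′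

  π-ordering : TopologicalOrdering R π
  π-ordering x y r with ≡⊎punchIn s x | ≡⊎punchIn s y
  ... | _                 | inj₁ refl         = contradiction r (s-source x)
  ... | inj₁ refl         | inj₂ (y′ , refl) rewrite π-source | π-punchIn y′ = z<s
  ... | inj₂ (x′ , refl) | inj₂ (y′ , refl) rewrite π-punchIn x′ | π-punchIn y′ = s<s (π′-ordering x′ y′ r)

distinct⇒<⊎> : ∀ {n} (c : Fin n ⤖ Fin n) {x y} → x ≢ y →
               Bijection.to c x < Bijection.to c y ⊎ Bijection.to c y < Bijection.to c x
distinct⇒<⊎> c {x} {y} x≢y with <-cmp (Bijection.to c x) (Bijection.to c y)
... | tri< lt _ _ = inj₁ lt
... | tri≈ _ eq _ = contradiction (Bijection.injective c eq) x≢y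
... | tri> _ _ gt = inj₂ gt

module _ {k n : ℕ} (D : Decoder k) (G : Graph n) where

  Realised : (Fin n → Fin k) → (Fin n ⤖ Fin n) → Fin n → Fin n → Set
  Realised ℓ c x y = (Arc D (ℓ x) (ℓ y) × c′ x < c′ y) ⊎ (Arc D (ℓ y) (ℓ x) × c′ y < c′ x)
    where c′ = Bijection.to c

  realised-by-both-arcs : ∀ ℓ c {x y} → x ≢ y → Arc D (ℓ x) (ℓ y) → Arc D (ℓ y) (ℓ x) → Realised ℓ c x y
  realised-by-both-arcs ℓ c x≢y r r′ = Sum.map (r ,_) (r′ ,_) (distinct⇒<⊎> c x≢y)

  adjacent⇒distinct : ∀ {x y} → Adj G x y → x ≢ y
  adjacent⇒distinct adj refl = irrefl G adj

  CGArc? : ∀ ℓ → Decidable (CGArc D G ℓ)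
  CGArc? ℓ x y = map′ from to
    ((arc? D (ℓ x) (ℓ y) ×-dec ¬? (arc? D (ℓ y) (ℓ x)) ×-dec adj? G x y)
      ⊎-dec (arc? D (ℓ y) (ℓ x) ×-dec ¬? (arc? D (ℓ x) (ℓ y)) ×-dec ¬? (adj? G x y)))
    where
    from : _ → CGArc D G ℓ x y
    from (inj₁ (r , nr , adj))  = fwd r nr adj
    from (inj₂ (r , nr , nadj)) = bwd r nr nadj
    to : CGArc D G ℓ x y → _
    to (fwd r nr adj)  = inj₁ (r , nr , adj)
    to (bwd r nr nadj) = inj₂ (r , nr , nadj)

  module Necessity (ℓ : Fin n → Fin k) (c : Fin n ⤖ Fin n) (realisation : IsLetterRealisation D G ℓ c) where

    adjacent⇒arc : ∀ {x y a b} → ℓ x ≡ a → ℓ y ≡ b → Adj G x y → Arc D a b ⊎ Arc D b a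
    adjacent⇒arc {x} {y} refl refl adj =
      Sum.map proj₁ proj₁ (proj₁ (realisation x y (adjacent⇒distinct adj)) adj)

    arcs⇒adjacent : ∀ {x y a b} → ℓ x ≡ a → ℓ y ≡ b → x ≢ y → Arc D a b → Arc D b a → Adj G x y
    arcs⇒adjacent {x} {y} refl refl x≢y r r′ =
      proj₂ (realisation x y x≢y) (realised-by-both-arcs ℓ c x≢y r r′)

    c1 : C1 D G ℓ
    c1 a (x , y , x≢y , ℓx≡a , ℓy≡a) =
      (λ clique → reduce (adjacent⇒arc ℓx≡a ℓy≡a (clique x y ℓx≡a ℓy≡a x≢y))) ,
      (λ loop x′ y′ ℓx′≡a ℓy′≡a x′≢y′ → arcs⇒adjacent ℓx′≡a ℓy′≡a x′≢y′ loop loop)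

    c2 : C2 D G ℓ
    c2 a two@(x , y , x≢y , ℓx≡a , ℓy≡a) =
      (λ independent loop → independent x y ℓx≡a ℓy≡a (proj₂ (c1 a two) loop x y ℓx≡a ℓy≡a x≢y)) ,
      (λ ¬loop x′ y′ ℓx′≡a ℓy′≡a adj → ¬loop (reduce (adjacent⇒arc ℓx′≡a ℓy′≡a adj)))

    c3 : C3 D G ℓ
    c3 a b a≢b =
      (λ r r′ x y ℓx≡a ℓy≡b → arcs⇒adjacent ℓx≡a ℓy≡b (λ x≡y → a≢b (distinct-letters x≡y ℓx≡a ℓy≡b)) r r′) ,
      (λ nr nr′ x y ℓx≡a ℓy≡b adj → Sum.[ nr , nr′ ] (adjacent⇒arc ℓx≡a ℓy≡b adj))
      where
      distinct-letters : ∀ {x y} → x ≡ y → ℓ x ≡ a → ℓ y ≡ b → a ≡ b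
      distinct-letters refl refl refl = refl

    CGArc⇒< : ∀ {x y} → CGArc D G ℓ x y → Bijection.to c x < Bijection.to c y
    CGArc⇒< {x} {y} (fwd r nr adj) with proj₁ (realisation x y (adjacent⇒distinct adj)) adj
    ... | inj₁ (_ , lt) = lt
    ... | inj₂ (r′ , _) = contradiction r′ nr
    CGArc⇒< {x} {y} (bwd r nr nadj) =
      Sum.[ id , (λ gt → contradiction (proj₂ (realisation x y x≢y) (inj₂ (r , gt))) nadj) ]
        (distinct⇒<⊎> c x≢y)
      where
      x≢y : x ≢ y
      x≢y refl = nr r

    c4 : C4 D G ℓ
    c4 = acyclic-pullback (Bijection.to c) CGArc⇒< <-acyclic

  module Sufficiency (ℓ : Fin n → Fin k) (c1 : C1 D G ℓ) (c2 : C2 D G ℓ) (c3 : C3 D G ℓ)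
                     (π : Fin n ⤖ Fin n) (topological : IsTopologicalOrdering D G ℓ π) where

    both-arcs⇒adjacent : ∀ {x y} → x ≢ y → Arc D (ℓ x) (ℓ y) → Arc D (ℓ y) (ℓ x) → Adj G x y
    both-arcs⇒adjacent {x} {y} x≢y r r′ with ℓ x ≟ ℓ y
    ... | yes ℓx≡ℓy = proj₂ (c1 (ℓ x) (x , y , x≢y , refl , ≡.sym ℓx≡ℓy))
                        (subst (Arc D (ℓ x)) (≡.sym ℓx≡ℓy) r) x y refl (≡.sym ℓx≡ℓy) x≢y
    ... | no  ℓx≢ℓy = proj₁ (c3 (ℓ x) (ℓ y) ℓx≢ℓy) r r′ x y refl refl

    no-arcs⇒non-adjacent : ∀ {x y} → x ≢ y → ¬ Arc D (ℓ x) (ℓ y) → ¬ Arc D (ℓ y) (ℓ x) → ¬ Adj G x y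
    no-arcs⇒non-adjacent {x} {y} x≢y nr nr′ with ℓ x ≟ ℓ y
    ... | yes ℓx≡ℓy = proj₂ (c2 (ℓ x) (x , y , x≢y , refl , ≡.sym ℓx≡ℓy))
                        (nr ∘ subst (Arc D (ℓ x)) ℓx≡ℓy) x y refl (≡.sym ℓx≡ℓy)
    ... | no  ℓx≢ℓy = proj₂ (c3 (ℓ x) (ℓ y) ℓx≢ℓy) nr nr′ x y refl refl

    RealisedAt : Fin n → Fin n → Set
    RealisedAt x y = (Adj G x y → Realised ℓ π x y) × (Realised ℓ π x y → Adj G x y)

    realisedAt-sym : ∀ {x y} → RealisedAt x y → RealisedAt y x
    realisedAt-sym (adj⇒realised , realised⇒adj) =
      (Sum.swap ∘ adj⇒realised ∘ sym G) , (sym G ∘ realised⇒adj ∘ Sum.swap)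

    one-arc⇒realisedAt : ∀ {x y} → Arc D (ℓ x) (ℓ y) → ¬ Arc D (ℓ y) (ℓ x) → RealisedAt x y
    one-arc⇒realisedAt {x} {y} r nr′ =
      (λ adj → inj₁ (r , topological x y (fwd r nr′ adj))) ,
      Sum.[ (λ (_ , lt) → decidable-stable (adj? G x y)
                            (λ nadj → <-asym lt (topological y x (bwd r nr′ (nadj ∘ sym G))))) ,
            (λ (r′ , _) → contradiction r′ nr′) ]

    realisation : IsLetterRealisation D G ℓ π
    realisation x y x≢y with arc? D (ℓ x) (ℓ y) | arc? D (ℓ y) (ℓ x)
    ... | yes r | yes r′ = const (realised-by-both-arcs ℓ π x≢y r r′) , const (both-arcs⇒adjacent x≢y r r′)
    ... | yes r | no nr′ = one-arc⇒realisedAt r nr′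
    ... | no nr | yes r′ = realisedAt-sym (one-arc⇒realisedAt r′ nr)
    ... | no nr | no nr′ = (⊥-elim ∘ no-arcs⇒non-adjacent x≢y nr nr′) ,
                           (⊥-elim ∘ Sum.[ nr ∘ proj₁ , nr′ ∘ proj₁ ])

  Conditions : (Fin n → Fin k) → Set
  Conditions ℓ = C1 D G ℓ × C2 D G ℓ × C3 D G ℓ × C4 D G ℓ

  letterGraph⇒conditions : IsLetterGraph D G → Σ (Fin n → Fin k) Conditions
  letterGraph⇒conditions (ℓ , c , realisation) = ℓ , c1 , c2 , c3 , c4
    where open Necessity ℓ c realisation

  conditions⇒letterGraph : Σ (Fin n → Fin k) Conditions → IsLetterGraph D G
  conditions⇒letterGraph (ℓ , c1 , c2 , c3 , c4) =
    let π , topological = topologicalOrdering (CGArc? ℓ) c4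
    in  ℓ , ↔⇒⤖ π , Sufficiency.realisation ℓ c1 c2 c3 (↔⇒⤖ π) topological

theorem3p2 : (k n : ℕ) (D : Decoder k) (G : Graph n) →
    ((IsLetterGraph D G →
        Σ (Fin n → Fin k) λ ℓ → C1 D G ℓ × C2 D G ℓ × C3 D G ℓ × C4 D G ℓ)
    × ((Σ (Fin n → Fin k) λ ℓ → C1 D G ℓ × C2 D G ℓ × C3 D G ℓ × C4 D G ℓ) →
        IsLetterGraph D G))
    × ((ℓ : Fin n → Fin k) → C1 D G ℓ → C2 D G ℓ → C3 D G ℓ → C4 D G ℓ →
        (π : Fin n ⤖ Fin n) → IsTopologicalOrdering D G ℓ π →
        IsLetterRealisation D G ℓ π)
theorem3p2 k n D G =
  (letterGraph⇒conditions D G , conditions⇒letterGraph D G) ,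
  λ ℓ c1 c2 c3 _ → Sufficiency.realisation D G ℓ c1 c2 c3
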